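{- There exists an $S(3,K_4^{(3)}+e,v)$ for every $v\in\{7,11,16,26,31,32\}$.
   Context: $K_4^{(3)}+e$ denotes the 3-uniform hypergraph with vertex set $\{1,2,3,4,5\}$ and edge set $\{\{1,2,3\},\{1,2,4\},\{1,3,4\},\{2,3,4\},\{3,4,5\}\}$. An $S(3,K_4^{(3)}+e,v)$ is a partition of the set of all 3-subsets of a $v$-set into sub-hypergraphs each isomorphic to $K_4^{(3)}+e$ (a decomposition of the complete 3-uniform hypergraph $K_v^{(3)}$ into copies of $K_4^{(3)}+e$). -}

module Defs where

open import Data.Nat using (ℕ)
open import Data.Bool.Properties using () renaming (_≟_ to _≟ᵇ_)
open import Data.Fin using (Fin; zero; suc)
open import Data.Fin.Subset using (Subset; ⁅_⁆; _∪_; ∣_∣)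
open import Data.Vec.Properties using (≡-dec)
open import Data.List using (List; []; _∷_; filter; length; concatMap)
open import Data.Product using (Σ)
open import Relation.Binary.PropositionalEquality using (_≡_)
open import Function.Definitions using (Injective)

-- A copy of K_4^(3)+e inside the vertex set Fin v: an injective labelling
-- of its vertices 1..5 (here Fin 5 : 0..4) by points of Fin v.
record Block (v : ℕ) : Set where
  field
    pt  : Fin 5 → Fin v
    inj : Injective _≡_ _≡_ pt
open Block public

triple : ∀ {v} → Fin v → Fin v → Fin v → Subset v
triple a b c = ⁅ a ⁆ ∪ (⁅ b ⁆ ∪ ⁅ c ⁆)

edges : ∀ {v} → Block v → List (Subset v)
edges B =
  triple x₁ x₂ x₃ ∷ triple x₁ x₂ x₄ ∷ triple x₁ x₃ x₄ ∷
  triple x₂ x₃ x₄ ∷ triple x₃ x₄ x₅ ∷ []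
  where
  x₁ = pt B zero
  x₂ = pt B (suc zero)
  x₃ = pt B (suc (suc zero))
  x₄ = pt B (suc (suc (suc zero)))
  x₅ = pt B (suc (suc (suc (suc zero))))

multiplicity : ∀ {v} → List (Block v) → Subset v → ℕ
multiplicity Bs T = length (filter (≡-dec _≟ᵇ_ T) (concatMap edges Bs))

IsDecomposition : (v : ℕ) → List (Block v) → Set
IsDecomposition v Bs = (T : Subset v) → ∣ T ∣ ≡ 3 → multiplicity Bs T ≡ 1

S3K4e : ℕ → Set
S3K4e v = Σ (List (Block v)) (IsDecomposition v)

module Submission where

-- All six designs are cyclic.  The group ℤ_v acts on the point set Fin v by
-- translation x ↦ x + i (mod v), and for each v ∈ {7, 11, 16, 26, 31, 32} we
-- list a few base blocks (1, 3, 7, 20, 29 and 31 of them) whose translates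
-- form an S(3, K₄⁽³⁾+e, v).  That these translates partition the 3-subsets is
-- a finite fact, settled by computation through a certificate that is cheap
-- to evaluate: code every subset injectively by a natural number; the sorted
-- list of codes of all edges must coincide with the sorted list of codes of
-- all 3-subsets, and the latter must be strictly increasing.

open import Defs
open import Data.Nat using (ℕ; zero; suc; pred; _+_; _*_; _<_; _<?_)
open import Data.Nat.Properties using (_≟_; ≤-decTotalOrder; <-trans; <⇒≢; +-assoc; *-cancelˡ-≡; even≢odd)
open import Data.Nat.Divisibility using (m∣m*n)
open import Data.Nat.DivMod using (_%_; _mod_; %-distribˡ-+; m%n%n≡m%n; %-remove-+ʳ; m<n⇒m%n≡m; m%n<n)
open import Data.Bool using (true; false)
open import Data.Bool.Properties using () renaming (_≟_ to _≟ᵇ_)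
open import Data.Fin using (Fin; toℕ)
open import Data.Fin.Properties using (toℕ-injective; toℕ-fromℕ<; toℕ<n) renaming (_≟_ to _≟ᶠ_)
open import Data.Fin.Subset using (Subset; ∣_∣)
open import Data.Vec as Vec using (Vec; []; _∷_; lookup)
open import Data.Vec.Properties using () renaming (≡-dec to ≡-decᵛ)
open import Data.Vec.Relation.Unary.AllPairs using () renaming (allPairs? to allPairsᵛ?)
open import Data.Vec.Relation.Unary.Unique.Propositional using () renaming (Unique to Uniqueᵛ)
open import Data.Vec.Relation.Unary.Unique.Propositional.Properties using (lookup-injective)
open import Data.List using (List; []; _∷_; filter; length; map; concatMap; _++_; upTo)
open import Data.List.Properties using (filter-accept; filter-reject; filter-none) renaming (≡-dec to ≡-decˡ)
open import Data.List.Membership.Propositional using (_∈_)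
open import Data.List.Membership.Propositional.Properties using (∈-map⁺; ∈-++⁺ˡ; ∈-++⁺ʳ)
open import Data.List.Relation.Unary.Any using (here; there)
import Data.List.Relation.Unary.All as All
open import Data.List.Relation.Unary.AllPairs as AllPairs using (_∷_)
open import Data.List.Relation.Unary.Unique.Propositional using (Unique)
open import Data.List.Relation.Unary.Linked using (Linked; linked?)
open import Data.List.Relation.Unary.Linked.Properties using (Linked⇒AllPairs)
open import Data.List.Relation.Binary.Permutation.Propositional using (_↭_; ↭-sym)
open import Data.List.Relation.Binary.Permutation.Propositional.Properties using (∈-resp-↭; ↭-length; filter-↭)
open import Data.List.Sort.MergeSort.Base ≤-decTotalOrder using (sort)
open import Data.List.Sort.MergeSort.Properties ≤-decTotalOrder using (sort-↭)
open import Data.Product using (_×_; _,_)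
open import Function using (_∘_)
open import Function.Definitions using (Injective)
open import Relation.Nullary using (Dec; yes; no; ¬?; _×-dec_)
open import Relation.Nullary.Decidable using (True; toWitness)
open import Relation.Binary.Definitions using (DecidableEquality)
open import Relation.Binary.PropositionalEquality using (_≡_; _≢_; refl; sym; trans; cong; module ≡-Reasoning)

module Occurrences {a} {A : Set a} (_≟ᴬ_ : DecidableEquality A) where

  count : A → List A → ℕ
  count x xs = length (filter (x ≟ᴬ_) xs)

  count-↭ : ∀ x {xs ys} → xs ↭ ys → count x xs ≡ count x ys
  count-↭ x xs↭ys = ↭-length (filter-↭ (x ≟ᴬ_) xs↭ys)

  count-unique : ∀ {x xs} → Unique xs → x ∈ xs → count x xs ≡ 1
  count-unique {x} (x∉xs ∷ _) (here refl) =
    cong length (trans (filter-accept (x ≟ᴬ_) refl) (cong (x ∷_) (filter-none (x ≟ᴬ_) x∉xs)))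
  count-unique {x} {y ∷ _} (y∉ys ∷ unique) (there x∈ys) =
    trans (cong length (filter-reject (x ≟ᴬ_) x≢y)) (count-unique unique x∈ys)
    where
    x≢y : x ≢ y
    x≢y x≡y = All.lookup y∉ys x∈ys (sym x≡y)

open Occurrences using (count; count-↭; count-unique)

count-map : ∀ {a b} {A : Set a} {B : Set b}
            (_≟ᴬ_ : DecidableEquality A) (_≟ᴮ_ : DecidableEquality B)
            {f : A → B} → Injective _≡_ _≡_ f →
            ∀ x xs → count _≟ᴮ_ (f x) (map f xs) ≡ count _≟ᴬ_ x xs
count-map _≟ᴬ_ _≟ᴮ_ f-inj x [] = refl
count-map _≟ᴬ_ _≟ᴮ_ {f} f-inj x (y ∷ ys) with x ≟ᴬ y
... | yes refl = trans (cong length (filter-accept (f x ≟ᴮ_) refl))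
                       (cong suc (count-map _≟ᴬ_ _≟ᴮ_ f-inj x ys))
... | no x≢y   = trans (cong length (filter-reject (f x ≟ᴮ_) (x≢y ∘ f-inj)))
                       (count-map _≟ᴬ_ _≟ᴮ_ f-inj x ys)

strictly-increasing⇒unique : ∀ {xs} → Linked _<_ xs → Unique xs
strictly-increasing⇒unique = AllPairs.map <⇒≢ ∘ Linked⇒AllPairs <-trans

code : ∀ {n} → Subset n → ℕ
code []          = 0
code (false ∷ p) = 2 * code p
code (true ∷ p)  = suc (2 * code p)

-- distinct subsets have distinct codes (parity decides the first bit)
code-injective : ∀ {n} → Injective _≡_ _≡_ (code {n})
code-injective {x = []}        {[]}        _  = refl
code-injective {x = false ∷ p} {false ∷ q} eq = cong (false ∷_) (code-injective (*-cancelˡ-≡ (code p) (code q) 2 eq))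
code-injective {x = true ∷ p}  {true ∷ q}  eq = cong (true ∷_) (code-injective (*-cancelˡ-≡ (code p) (code q) 2 (cong pred eq)))
code-injective {x = false ∷ p} {true ∷ q}  eq with () ← even≢odd (code p) (code q) eq
code-injective {x = true ∷ p}  {false ∷ q} eq with () ← even≢odd (code q) (code p) (sym eq)

subsetsOfSize : (n k : ℕ) → List (Subset n)
subsetsOfSize zero    zero    = [] ∷ []
subsetsOfSize zero    (suc k) = []
subsetsOfSize (suc n) zero    = map (false ∷_) (subsetsOfSize n zero)
subsetsOfSize (suc n) (suc k) = map (true ∷_) (subsetsOfSize n k) ++ map (false ∷_) (subsetsOfSize n (suc k))

subsetsOfSize-complete : ∀ {n} (p : Subset n) k → ∣ p ∣ ≡ k → p ∈ subsetsOfSize n k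
subsetsOfSize-complete []          zero    _  = here refl
subsetsOfSize-complete (true ∷ p)  (suc k) eq =
  ∈-++⁺ˡ (∈-map⁺ (true ∷_) (subsetsOfSize-complete p k (cong pred eq)))
subsetsOfSize-complete (false ∷ p) zero    eq = ∈-map⁺ (false ∷_) (subsetsOfSize-complete p zero eq)
subsetsOfSize-complete {suc n} (false ∷ p) (suc k) eq =
  ∈-++⁺ʳ (map (true ∷_) (subsetsOfSize n k)) (∈-map⁺ (false ∷_) (subsetsOfSize-complete p (suc k) eq))

edgeCodes : ∀ {v} → List (Block v) → List ℕ
edgeCodes Bs = sort (map code (concatMap edges Bs))

tripleCodes : ℕ → List ℕ
tripleCodes v = sort (map code (subsetsOfSize v 3))

Certificate : (v : ℕ) → List (Block v) → Set
Certificate v Bs = edgeCodes Bs ≡ tripleCodes v × Linked _<_ (tripleCodes v)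

certificate? : ∀ v (Bs : List (Block v)) → Dec (Certificate v Bs)
certificate? v Bs = ≡-decˡ _≟_ (edgeCodes Bs) (tripleCodes v) ×-dec linked? _<?_ (tripleCodes v)

-- A certified family is a decomposition: the multiplicity of a 3-subset T is
-- the number of occurrences of its code among the edge codes, i.e. among the
-- codes of all 3-subsets, where it occurs exactly once.
certificate-sound : ∀ {v Bs} → Certificate v Bs → IsDecomposition v Bs
certificate-sound {v} {Bs} (edges≡triples , increasing) T ∣T∣≡3 = begin
  multiplicity Bs T                                 ≡⟨ count-map _≟ˢ_ _≟_ code-injective T Es ⟨
  count _≟_ (code T) (map code Es)                  ≡⟨ count-↭ _≟_ (code T) (↭-sym (sort-↭ (map code Es))) ⟩
  count _≟_ (code T) (edgeCodes Bs)                 ≡⟨ cong (count _≟_ (code T)) edges≡triples ⟩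
  count _≟_ (code T) (tripleCodes v)                ≡⟨ count-unique _≟_ (strictly-increasing⇒unique increasing) code-T∈triples ⟩
  1                                                 ∎
  where
  open ≡-Reasoning
  _≟ˢ_ : DecidableEquality (Subset v)
  _≟ˢ_ = ≡-decᵛ _≟ᵇ_
  Es = concatMap edges Bs
  code-T∈triples : code T ∈ tripleCodes v
  code-T∈triples = ∈-resp-↭ (↭-sym (sort-↭ _)) (∈-map⁺ code (subsetsOfSize-complete T 3 ∣T∣≡3))

block : ∀ {v} (xs : Vec (Fin v) 5) → Uniqueᵛ xs → Block v
block xs distinct = record { pt = lookup xs ; inj = lookup-injective distinct _ _ }

distinct? : ∀ {v m} (xs : Vec (Fin v) m) → Dec (Uniqueᵛ xs)
distinct? = allPairsᵛ? (λ x y → ¬? (x ≟ᶠ y))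

baseBlock : ∀ {n} (xs : Vec ℕ 5) → {True (distinct? (Vec.map (_mod suc n) xs))} → Block (suc n)
baseBlock xs {distinct} = block _ (toWitness distinct)

module Translation {n : ℕ} where

  _⊕_ : Fin (suc n) → ℕ → Fin (suc n)
  x ⊕ i = (toℕ x + i) mod suc n

  toℕ-mod : ∀ m → toℕ (m mod suc n) ≡ m % suc n
  toℕ-mod m = toℕ-fromℕ< (m%n<n m (suc n))

  -- translating by i and then by n * i is the identity, as i + n * i = (n + 1) * i
  ⊕-inverse : ∀ x i → (x ⊕ i) ⊕ (n * i) ≡ x
  ⊕-inverse x i = toℕ-injective (begin
    toℕ ((x ⊕ i) ⊕ (n * i))            ≡⟨ toℕ-mod (toℕ (x ⊕ i) + n * i) ⟩
    (toℕ (x ⊕ i) + n * i) % v          ≡⟨ cong (λ y → (y + n * i) % v) (toℕ-mod (x′ + i)) ⟩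
    ((x′ + i) % v + n * i) % v         ≡⟨ %-distribˡ-+ ((x′ + i) % v) (n * i) v ⟩
    ((x′ + i) % v % v + n * i % v) % v ≡⟨ cong (λ y → (y + n * i % v) % v) (m%n%n≡m%n (x′ + i) v) ⟩
    ((x′ + i) % v + n * i % v) % v     ≡⟨ %-distribˡ-+ (x′ + i) (n * i) v ⟨
    (x′ + i + n * i) % v               ≡⟨ cong (_% v) (+-assoc x′ i (n * i)) ⟩
    (x′ + v * i) % v                   ≡⟨ %-remove-+ʳ x′ (m∣m*n i) ⟩
    x′ % v                             ≡⟨ m<n⇒m%n≡m (toℕ<n x) ⟩
    x′                                 ∎)
    where
    open ≡-Reasoning
    v = suc n
    x′ = toℕ x

  ⊕-injective : ∀ i {x y} → x ⊕ i ≡ y ⊕ i → x ≡ y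
  ⊕-injective i {x} {y} eq = begin
    x                   ≡⟨ ⊕-inverse x i ⟨
    (x ⊕ i) ⊕ (n * i)   ≡⟨ cong (_⊕ (n * i)) eq ⟩
    (y ⊕ i) ⊕ (n * i)   ≡⟨ ⊕-inverse y i ⟩
    y                   ∎
    where open ≡-Reasoning

  translate : ℕ → Block (suc n) → Block (suc n)
  translate i B = record { pt = λ k → pt B k ⊕ i ; inj = inj B ∘ ⊕-injective i }

  orbit : Block (suc n) → List (Block (suc n))
  orbit B = map (λ i → translate i B) (upTo (suc n))

  develop : List (Block (suc n)) → List (Block (suc n))
  develop = concatMap orbit

open Translation using (develop)

cyclicDecomposition : ∀ {n} (bases : List (Block (suc n))) →
                      {True (certificate? (suc n) (develop bases))} → S3K4e (suc n)
cyclicDecomposition bases {certified} = develop bases , certificate-sound {Bs = develop bases} (toWitness certified)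

-- Base blocks of the six cyclic designs: base v lists one representative
-- (x₁, …, x₅) of each orbit, with edges x₁x₂x₃, x₁x₂x₄, x₁x₃x₄, x₂x₃x₄, x₃x₄x₅.
base7 : List (Block 7)
base7 =
  baseBlock (0 ∷ 1 ∷ 2 ∷ 4 ∷ 5 ∷ []) ∷ []

base11 : List (Block 11)
base11 =
  baseBlock (0 ∷ 1 ∷ 2 ∷ 4 ∷ 5 ∷ []) ∷
  baseBlock (0 ∷ 3 ∷ 4 ∷ 8 ∷ 9 ∷ []) ∷
  baseBlock (0 ∷ 5 ∷ 2 ∷ 7 ∷ 1 ∷ []) ∷ []

base16 : List (Block 16)
base16 =
  baseBlock (0 ∷ 3 ∷ 13 ∷ 14 ∷ 12 ∷ []) ∷
  baseBlock (0 ∷ 1 ∷ 9 ∷ 10 ∷ 4 ∷ []) ∷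
  baseBlock (0 ∷ 6 ∷ 11 ∷ 4 ∷ 14 ∷ []) ∷
  baseBlock (0 ∷ 1 ∷ 12 ∷ 13 ∷ 10 ∷ []) ∷
  baseBlock (0 ∷ 3 ∷ 12 ∷ 5 ∷ 8 ∷ []) ∷
  baseBlock (0 ∷ 9 ∷ 14 ∷ 6 ∷ 3 ∷ []) ∷
  baseBlock (0 ∷ 6 ∷ 12 ∷ 8 ∷ 10 ∷ []) ∷ []

base26 : List (Block 26)
base26 =
  baseBlock (0 ∷ 10 ∷ 11 ∷ 15 ∷ 3 ∷ []) ∷
  baseBlock (0 ∷ 14 ∷ 21 ∷ 5 ∷ 20 ∷ []) ∷
  baseBlock (0 ∷ 23 ∷ 24 ∷ 20 ∷ 1 ∷ []) ∷
  baseBlock (0 ∷ 4 ∷ 13 ∷ 14 ∷ 6 ∷ []) ∷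
  baseBlock (0 ∷ 5 ∷ 17 ∷ 24 ∷ 9 ∷ []) ∷
  baseBlock (0 ∷ 9 ∷ 17 ∷ 11 ∷ 21 ∷ []) ∷
  baseBlock (0 ∷ 5 ∷ 20 ∷ 12 ∷ 4 ∷ []) ∷
  baseBlock (0 ∷ 14 ∷ 17 ∷ 3 ∷ 18 ∷ []) ∷
  baseBlock (0 ∷ 17 ∷ 22 ∷ 6 ∷ 23 ∷ []) ∷
  baseBlock (0 ∷ 1 ∷ 22 ∷ 4 ∷ 25 ∷ []) ∷
  baseBlock (0 ∷ 6 ∷ 12 ∷ 14 ∷ 23 ∷ []) ∷
  baseBlock (0 ∷ 4 ∷ 2 ∷ 12 ∷ 25 ∷ []) ∷
  baseBlock (0 ∷ 21 ∷ 24 ∷ 13 ∷ 25 ∷ []) ∷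
  baseBlock (0 ∷ 1 ∷ 6 ∷ 7 ∷ 24 ∷ []) ∷
  baseBlock (0 ∷ 6 ∷ 23 ∷ 16 ∷ 3 ∷ []) ∷
  baseBlock (0 ∷ 6 ∷ 9 ∷ 13 ∷ 25 ∷ []) ∷
  baseBlock (0 ∷ 1 ∷ 2 ∷ 9 ∷ 24 ∷ []) ∷
  baseBlock (0 ∷ 4 ∷ 19 ∷ 24 ∷ 15 ∷ []) ∷
  baseBlock (0 ∷ 13 ∷ 10 ∷ 12 ∷ 2 ∷ []) ∷
  baseBlock (0 ∷ 13 ∷ 2 ∷ 5 ∷ 12 ∷ []) ∷ []

base31 : List (Block 31)
base31 =
  baseBlock (0 ∷ 14 ∷ 30 ∷ 27 ∷ 9 ∷ []) ∷
  baseBlock (0 ∷ 4 ∷ 22 ∷ 15 ∷ 19 ∷ []) ∷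
  baseBlock (0 ∷ 19 ∷ 23 ∷ 13 ∷ 24 ∷ []) ∷
  baseBlock (0 ∷ 1 ∷ 9 ∷ 12 ∷ 30 ∷ []) ∷
  baseBlock (0 ∷ 2 ∷ 20 ∷ 22 ∷ 13 ∷ []) ∷
  baseBlock (0 ∷ 2 ∷ 26 ∷ 9 ∷ 23 ∷ []) ∷
  baseBlock (0 ∷ 25 ∷ 1 ∷ 13 ∷ 28 ∷ []) ∷
  baseBlock (0 ∷ 3 ∷ 8 ∷ 24 ∷ 14 ∷ []) ∷
  baseBlock (0 ∷ 11 ∷ 16 ∷ 28 ∷ 18 ∷ []) ∷
  baseBlock (0 ∷ 2 ∷ 3 ∷ 7 ∷ 30 ∷ []) ∷
  baseBlock (0 ∷ 6 ∷ 8 ∷ 12 ∷ 29 ∷ []) ∷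
  baseBlock (0 ∷ 16 ∷ 3 ∷ 9 ∷ 29 ∷ []) ∷
  baseBlock (0 ∷ 10 ∷ 9 ∷ 19 ∷ 1 ∷ []) ∷
  baseBlock (0 ∷ 3 ∷ 12 ∷ 28 ∷ 17 ∷ []) ∷
  baseBlock (0 ∷ 11 ∷ 23 ∷ 25 ∷ 22 ∷ []) ∷
  baseBlock (0 ∷ 6 ∷ 1 ∷ 20 ∷ 30 ∷ []) ∷
  baseBlock (0 ∷ 2 ∷ 16 ∷ 10 ∷ 21 ∷ []) ∷
  baseBlock (0 ∷ 2 ∷ 23 ∷ 28 ∷ 5 ∷ []) ∷
  baseBlock (0 ∷ 22 ∷ 30 ∷ 13 ∷ 5 ∷ []) ∷
  baseBlock (0 ∷ 10 ∷ 17 ∷ 21 ∷ 30 ∷ []) ∷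
  baseBlock (0 ∷ 11 ∷ 24 ∷ 19 ∷ 23 ∷ []) ∷
  baseBlock (0 ∷ 5 ∷ 27 ∷ 2 ∷ 26 ∷ []) ∷
  baseBlock (0 ∷ 11 ∷ 20 ∷ 3 ∷ 22 ∷ []) ∷
  baseBlock (0 ∷ 13 ∷ 14 ∷ 15 ∷ 22 ∷ []) ∷
  baseBlock (0 ∷ 10 ∷ 30 ∷ 3 ∷ 18 ∷ []) ∷
  baseBlock (0 ∷ 7 ∷ 23 ∷ 8 ∷ 19 ∷ []) ∷
  baseBlock (0 ∷ 2 ∷ 29 ∷ 15 ∷ 24 ∷ []) ∷
  baseBlock (0 ∷ 1 ∷ 19 ∷ 26 ∷ 5 ∷ []) ∷
  baseBlock (0 ∷ 25 ∷ 16 ∷ 21 ∷ 3 ∷ []) ∷ []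

base32 : List (Block 32)
base32 =
  baseBlock (0 ∷ 17 ∷ 22 ∷ 25 ∷ 20 ∷ []) ∷
  baseBlock (0 ∷ 6 ∷ 25 ∷ 5 ∷ 17 ∷ []) ∷
  baseBlock (0 ∷ 18 ∷ 30 ∷ 19 ∷ 1 ∷ []) ∷
  baseBlock (0 ∷ 6 ∷ 31 ∷ 3 ∷ 21 ∷ []) ∷
  baseBlock (0 ∷ 14 ∷ 30 ∷ 31 ∷ 8 ∷ []) ∷
  baseBlock (0 ∷ 5 ∷ 29 ∷ 31 ∷ 16 ∷ []) ∷
  baseBlock (0 ∷ 10 ∷ 29 ∷ 17 ∷ 25 ∷ []) ∷
  baseBlock (0 ∷ 3 ∷ 16 ∷ 5 ∷ 26 ∷ []) ∷
  baseBlock (0 ∷ 1 ∷ 3 ∷ 24 ∷ 18 ∷ []) ∷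
  baseBlock (0 ∷ 25 ∷ 30 ∷ 2 ∷ 15 ∷ []) ∷
  baseBlock (0 ∷ 19 ∷ 28 ∷ 5 ∷ 17 ∷ []) ∷
  baseBlock (0 ∷ 13 ∷ 23 ∷ 24 ∷ 28 ∷ []) ∷
  baseBlock (0 ∷ 3 ∷ 12 ∷ 17 ∷ 25 ∷ []) ∷
  baseBlock (0 ∷ 17 ∷ 2 ∷ 11 ∷ 28 ∷ []) ∷
  baseBlock (0 ∷ 8 ∷ 28 ∷ 17 ∷ 24 ∷ []) ∷
  baseBlock (0 ∷ 26 ∷ 28 ∷ 1 ∷ 6 ∷ []) ∷
  baseBlock (0 ∷ 5 ∷ 11 ∷ 18 ∷ 14 ∷ []) ∷
  baseBlock (0 ∷ 24 ∷ 30 ∷ 16 ∷ 1 ∷ []) ∷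
  baseBlock (0 ∷ 3 ∷ 4 ∷ 11 ∷ 29 ∷ []) ∷
  baseBlock (0 ∷ 9 ∷ 27 ∷ 16 ∷ 22 ∷ []) ∷
  baseBlock (0 ∷ 4 ∷ 8 ∷ 19 ∷ 9 ∷ []) ∷
  baseBlock (0 ∷ 7 ∷ 30 ∷ 8 ∷ 24 ∷ []) ∷
  baseBlock (0 ∷ 12 ∷ 29 ∷ 11 ∷ 1 ∷ []) ∷
  baseBlock (0 ∷ 17 ∷ 27 ∷ 7 ∷ 25 ∷ []) ∷
  baseBlock (0 ∷ 14 ∷ 26 ∷ 13 ∷ 23 ∷ []) ∷
  baseBlock (0 ∷ 6 ∷ 26 ∷ 4 ∷ 24 ∷ []) ∷
  baseBlock (0 ∷ 7 ∷ 16 ∷ 10 ∷ 19 ∷ []) ∷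
  baseBlock (0 ∷ 6 ∷ 28 ∷ 14 ∷ 2 ∷ []) ∷
  baseBlock (0 ∷ 9 ∷ 28 ∷ 12 ∷ 27 ∷ []) ∷
  baseBlock (0 ∷ 15 ∷ 24 ∷ 2 ∷ 16 ∷ []) ∷
  baseBlock (0 ∷ 8 ∷ 25 ∷ 13 ∷ 29 ∷ []) ∷ []

lemma3p1 : (v : ℕ) → v ∈ (7 ∷ 11 ∷ 16 ∷ 26 ∷ 31 ∷ 32 ∷ []) → S3K4e v
lemma3p1 .7  (here refl) = cyclicDecomposition base7
lemma3p1 .11 (there (here refl)) = cyclicDecomposition base11
lemma3p1 .16 (there (there (here refl))) = cyclicDecomposition base16
lemma3p1 .26 (there (there (there (here refl)))) = cyclicDecomposition base26
lemma3p1 .31 (there (there (there (there (here refl))))) = cyclicDecomposition base31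
lemma3p1 .32 (there (there (there (there (there (here refl)))))) = cyclicDecomposition base32
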